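{- Let $G$ be a graph such that $C_4+G$ has no isolated vertices, and let $H=C_4+G+N_k$ (for some $k\ge 0$) be a sum graph with sum labelling $\lambda$. Let $S=\{\lambda(x)+\lambda(y) : xy \text{ an edge of the } C_4\}$. If $|S|=3$, then the three elements of $S$ form an arithmetic progression.
   Context: A graph $H=(V,E)$ is a sum graph with sum labelling $\lambda$ if $\lambda:V\to\mathbb{N}$ is injective and $E=\{xy : \exists z\in V,\ \lambda(z)=\lambda(x)+\lambda(y)\}$. $N_k$ denotes $k$ isolated vertices and $+$ denotes disjoint union; $C_4$ is the 4-cycle. -}

module Defs where

open import Data.Nat using (ℕ; zero; suc; _+_; _*_)
open import Data.Fin using (Fin; zero; suc)
open import Data.Sum using (_⊎_; inj₁; inj₂)
open import Data.Product using (Σ; ∃; ∃-syntax; _×_; _,_)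
open import Data.Empty using (⊥)
open import Data.Unit using (⊤; tt)
open import Relation.Nullary using (¬_)
open import Relation.Binary.PropositionalEquality using (_≡_; _≢_)
open import Function.Definitions using (Injective)
open import Function.Bundles using (_⇔_)

record Graph (V : Set) : Set₁ where
  field
    Adj    : V → V → Set
    sym    : ∀ {x y} → Adj x y → Adj y x
    irrefl : ∀ {x} → ¬ Adj x x
open Graph public

_⊕_ : ∀ {V W} → Graph V → Graph W → Graph (V ⊎ W)
_⊕_ {V} {W} G H = record { Adj = A ; sym = λ {x} {y} → s {x} {y} ; irrefl = λ {x} → i {x} }
  where
  A : V ⊎ W → V ⊎ W → Set
  A (inj₁ x) (inj₁ y) = Adj G x y
  A (inj₂ x) (inj₂ y) = Adj H x y
  A _ _ = ⊥
  s : ∀ {x y} → A x y → A y x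
  s {inj₁ x} {inj₁ y} p = sym G p
  s {inj₂ x} {inj₂ y} p = sym H p
  i : ∀ {x} → ¬ A x x
  i {inj₁ x} = irrefl G
  i {inj₂ x} = irrefl H

C4Adj : Fin 4 → Fin 4 → Set
C4Adj zero (suc zero) = ⊤
C4Adj (suc zero) zero = ⊤
C4Adj (suc zero) (suc (suc zero)) = ⊤
C4Adj (suc (suc zero)) (suc zero) = ⊤
C4Adj (suc (suc zero)) (suc (suc (suc zero))) = ⊤
C4Adj (suc (suc (suc zero))) (suc (suc zero)) = ⊤
C4Adj (suc (suc (suc zero))) zero = ⊤
C4Adj zero (suc (suc (suc zero))) = ⊤
C4Adj _ _ = ⊥

C4 : Graph (Fin 4)
C4 = record { Adj = C4Adj ; sym = λ {x} {y} → s {x} {y} ; irrefl = λ {x} → i {x} }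
  where
  s : ∀ {x y} → C4Adj x y → C4Adj y x
  s {zero} {suc zero} _ = tt
  s {suc zero} {zero} _ = tt
  s {suc zero} {suc (suc zero)} _ = tt
  s {suc (suc zero)} {suc zero} _ = tt
  s {suc (suc zero)} {suc (suc (suc zero))} _ = tt
  s {suc (suc (suc zero))} {suc (suc zero)} _ = tt
  s {suc (suc (suc zero))} {zero} _ = tt
  s {zero} {suc (suc (suc zero))} _ = tt
  i : ∀ {x} → ¬ C4Adj x x
  i {zero} ()
  i {suc zero} ()
  i {suc (suc zero)} ()
  i {suc (suc (suc zero))} ()

N : (k : ℕ) → Graph (Fin k)
N k = record { Adj = λ _ _ → ⊥ ; sym = λ () ; irrefl = λ () }

NoIsolatedVertices : ∀ {V} → Graph V → Set
NoIsolatedVertices {V} G = ∀ (x : V) → ∃[ y ] Adj G x y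

IsSumLabelling : ∀ {V} → Graph V → (V → ℕ) → Set
IsSumLabelling {V} H l =
  Injective _≡_ _≡_ l ×
  (∀ (x y : V) → Adj H x y ⇔ (x ≢ y × ∃[ z ] l z ≡ l x + l y))

_∈₃_ : ℕ → ℕ × ℕ × ℕ → Set
s ∈₃ (a , b , c) = (s ≡ a) ⊎ (s ≡ b) ⊎ (s ≡ c)

IsAP₃ : ℕ → ℕ → ℕ → Set
IsAP₃ a b c = (a + c ≡ 2 * b) ⊎ (a + b ≡ 2 * c) ⊎ (b + c ≡ 2 * a)

module Submission where

-- The four edge sums p, q, r, t of the 4-cycle, read cyclically, satisfy p + r = q + t,
-- and consecutive ones differ because λ is injective. Three values on a 4-cycle with
-- distinct neighbours force one opposite pair to coincide, say p = r; then q and t are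
-- the other two values and 2p = q + t.

open import Defs
open import Data.Nat using (ℕ; _+_; _*_)
open import Data.Nat.Properties using (_≟_; +-comm; +-identityʳ; +-cancelʳ-≡)
open import Data.Nat.Tactic.RingSolver using (solve-∀)
open import Data.Fin using (Fin; zero; suc)
open import Data.Sum using (_⊎_; inj₁; inj₂)
open import Data.Product using (_,_)
open import Data.Empty using (⊥; ⊥-elim)
open import Function.Definitions using (Injective)
open import Relation.Nullary using (yes; no)
open import Relation.Binary.PropositionalEquality as ≡ using (_≡_; _≢_; refl; trans; cong; ≢-sym)

∈₃-rotate : ∀ {s a b c} → s ∈₃ (a , b , c) → s ∈₃ (b , c , a)
∈₃-rotate (inj₁ s≡a)        = inj₂ (inj₂ s≡a)
∈₃-rotate (inj₂ (inj₁ s≡b)) = inj₁ s≡b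
∈₃-rotate (inj₂ (inj₂ s≡c)) = inj₂ (inj₁ s≡c)

IsAP₃-rotate : ∀ {a b c} → IsAP₃ b c a → IsAP₃ a b c
IsAP₃-rotate {a} {b} {c} (inj₁ e)        = inj₂ (inj₁ (trans (+-comm a b) e))
IsAP₃-rotate             (inj₂ (inj₁ e)) = inj₂ (inj₂ e)
IsAP₃-rotate {a} {b} {c} (inj₂ (inj₂ e)) = inj₁ (trans (+-comm a c) e)

n+n≡2*n : ∀ n → n + n ≡ 2 * n
n+n≡2*n n = cong (n +_) (≡.sym (+-identityʳ n))

pair-pigeonhole : ∀ {x y p q r : ℕ} → p ≢ q → q ≢ r → p ≢ r →
                  (p ≡ x ⊎ p ≡ y) → (q ≡ x ⊎ q ≡ y) → (r ≡ x ⊎ r ≡ y) → ⊥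
pair-pigeonhole p≢q _   _   (inj₁ refl) (inj₁ refl) _           = p≢q refl
pair-pigeonhole p≢q _   _   (inj₂ refl) (inj₂ refl) _           = p≢q refl
pair-pigeonhole _   _   p≢r (inj₁ refl) (inj₂ refl) (inj₁ refl) = p≢r refl
pair-pigeonhole _   q≢r _   (inj₁ refl) (inj₂ refl) (inj₂ refl) = q≢r refl
pair-pigeonhole _   q≢r _   (inj₂ refl) (inj₁ refl) (inj₁ refl) = q≢r refl
pair-pigeonhole _   _   p≢r (inj₂ refl) (inj₁ refl) (inj₂ refl) = p≢r refl

distinct-∈₃-cover : ∀ {a b c p q r s} →
                    p ∈₃ (a , b , c) → q ∈₃ (a , b , c) → r ∈₃ (a , b , c) →
                    p ≢ q → q ≢ r → p ≢ r → s ∈₃ (a , b , c) →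
                    s ≡ p ⊎ s ≡ q ⊎ s ≡ r
distinct-∈₃-cover p∈ q∈ r∈ p≢q q≢r p≢r (inj₁ refl) =
  cover-first p∈ q∈ r∈ p≢q q≢r p≢r
  where
  cover-first : ∀ {a b c p q r} →
                p ∈₃ (a , b , c) → q ∈₃ (a , b , c) → r ∈₃ (a , b , c) →
                p ≢ q → q ≢ r → p ≢ r → a ≡ p ⊎ a ≡ q ⊎ a ≡ r
  cover-first (inj₁ refl) _           _           _   _   _   = inj₁ refl
  cover-first (inj₂ _)    (inj₁ refl) _           _   _   _   = inj₂ (inj₁ refl)
  cover-first (inj₂ _)    (inj₂ _)    (inj₁ refl) _   _   _   = inj₂ (inj₂ refl)
  cover-first (inj₂ p∈)   (inj₂ q∈)   (inj₂ r∈)   p≢q q≢r p≢r =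
    ⊥-elim (pair-pigeonhole p≢q q≢r p≢r p∈ q∈ r∈)
distinct-∈₃-cover p∈ q∈ r∈ p≢q q≢r p≢r (inj₂ (inj₁ refl)) =
  distinct-∈₃-cover (∈₃-rotate p∈) (∈₃-rotate q∈) (∈₃-rotate r∈) p≢q q≢r p≢r (inj₁ refl)
distinct-∈₃-cover p∈ q∈ r∈ p≢q q≢r p≢r (inj₂ (inj₂ refl)) =
  distinct-∈₃-cover (∈₃-rotate (∈₃-rotate p∈)) (∈₃-rotate (∈₃-rotate q∈))
                    (∈₃-rotate (∈₃-rotate r∈)) p≢q q≢r p≢r (inj₁ refl)

sum-of-others : ∀ {a b c y z} → y ∈₃ (a , b , c) → z ∈₃ (a , b , c) →
                y ≢ a → z ≢ a → y ≢ z → y + z ≡ b + c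
sum-of-others (inj₁ y≡a) _ y≢a _ _ = ⊥-elim (y≢a y≡a)
sum-of-others _ (inj₁ z≡a) _ z≢a _ = ⊥-elim (z≢a z≡a)
sum-of-others (inj₂ (inj₁ refl)) (inj₂ (inj₁ refl)) _ _ y≢z = ⊥-elim (y≢z refl)
sum-of-others (inj₂ (inj₁ refl)) (inj₂ (inj₂ refl)) _ _ _   = refl
sum-of-others {b = b} {c} (inj₂ (inj₂ refl)) (inj₂ (inj₁ refl)) _ _ _ = +-comm c b
sum-of-others (inj₂ (inj₂ refl)) (inj₂ (inj₂ refl)) _ _ y≢z = ⊥-elim (y≢z refl)

middle-IsAP₃ : ∀ {a b c x y z} →
               x ∈₃ (a , b , c) → y ∈₃ (a , b , c) → z ∈₃ (a , b , c) →
               x ≢ y → x ≢ z → y ≢ z → y + z ≡ 2 * x → IsAP₃ a b c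
middle-IsAP₃ (inj₁ refl) y∈ z∈ x≢y x≢z y≢z e =
  inj₂ (inj₂ (trans (≡.sym (sum-of-others y∈ z∈ (≢-sym x≢y) (≢-sym x≢z) y≢z)) e))
middle-IsAP₃ {a} {b} {c} (inj₂ (inj₁ refl)) y∈ z∈ x≢y x≢z y≢z e =
  IsAP₃-rotate {a} {b} {c} (middle-IsAP₃ (inj₁ refl) (∈₃-rotate y∈) (∈₃-rotate z∈) x≢y x≢z y≢z e)
middle-IsAP₃ {a} {b} {c} (inj₂ (inj₂ refl)) y∈ z∈ x≢y x≢z y≢z e =
  IsAP₃-rotate {a} {b} {c} (IsAP₃-rotate {b} {c} {a}
    (middle-IsAP₃ (inj₁ refl) (∈₃-rotate (∈₃-rotate y∈)) (∈₃-rotate (∈₃-rotate z∈))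
                  x≢y x≢z y≢z e))

opposite-values-coincide : ∀ {a b c p q r t} →
                           p ∈₃ (a , b , c) → q ∈₃ (a , b , c) →
                           r ∈₃ (a , b , c) → t ∈₃ (a , b , c) →
                           p ≢ q → q ≢ r → r ≢ t → t ≢ p → p ≡ r ⊎ q ≡ t
opposite-values-coincide {p = p} {r = r} p∈ q∈ r∈ t∈ p≢q q≢r r≢t t≢p with p ≟ r
... | yes p≡r = inj₁ p≡r
... | no p≢r with distinct-∈₃-cover p∈ q∈ r∈ p≢q q≢r p≢r t∈
...   | inj₁ t≡p        = ⊥-elim (t≢p t≡p)
...   | inj₂ (inj₁ t≡q) = inj₂ (≡.sym t≡q)
...   | inj₂ (inj₂ t≡r) = ⊥-elim (r≢t (≡.sym t≡r))

repeated-value-IsAP₃ : ∀ {a b c x y z} → a ≢ b → b ≢ c → a ≢ c →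
                       x ∈₃ (a , b , c) → y ∈₃ (a , b , c) → z ∈₃ (a , b , c) →
                       x ≢ y → x ≢ z →
                       (∀ s → s ∈₃ (a , b , c) → s ≡ x ⊎ s ≡ y ⊎ s ≡ z) →
                       x + x ≡ y + z → IsAP₃ a b c
repeated-value-IsAP₃ {a} {b} {c} {x} {y} {z} a≢b b≢c a≢c x∈ y∈ z∈ x≢y x≢z covered e =
  middle-IsAP₃ x∈ y∈ z∈ x≢y x≢z y≢z (trans (≡.sym e) (n+n≡2*n x))
  where
  y≢z : y ≢ z
  y≢z refl = pair-pigeonhole a≢b b≢c a≢c (two-valued a (inj₁ refl))
               (two-valued b (inj₂ (inj₁ refl))) (two-valued c (inj₂ (inj₂ refl)))
    where
    two-valued : ∀ s → s ∈₃ (a , b , c) → s ≡ x ⊎ s ≡ y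
    two-valued s s∈ with covered s s∈
    ... | inj₁ s≡x        = inj₁ s≡x
    ... | inj₂ (inj₁ s≡y) = inj₂ s≡y
    ... | inj₂ (inj₂ s≡y) = inj₂ s≡y

cycle-sums-IsAP₃ : ∀ {a b c p q r t} → a ≢ b → b ≢ c → a ≢ c →
                   p ∈₃ (a , b , c) → q ∈₃ (a , b , c) →
                   r ∈₃ (a , b , c) → t ∈₃ (a , b , c) →
                   p ≢ q → q ≢ r → r ≢ t → t ≢ p → p + r ≡ q + t →
                   (∀ s → s ∈₃ (a , b , c) → s ≡ p ⊎ s ≡ q ⊎ s ≡ r ⊎ s ≡ t) →
                   IsAP₃ a b c
cycle-sums-IsAP₃ {a} {b} {c} {p} {q} {r} {t} a≢b b≢c a≢c p∈ q∈ r∈ t∈ p≢q q≢r r≢t t≢p e covered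
  with opposite-values-coincide p∈ q∈ r∈ t∈ p≢q q≢r r≢t t≢p
... | inj₁ refl =
  repeated-value-IsAP₃ a≢b b≢c a≢c p∈ q∈ t∈ p≢q (≢-sym t≢p) covered′ e
  where
  covered′ : ∀ s → s ∈₃ (a , b , c) → s ≡ p ⊎ s ≡ q ⊎ s ≡ t
  covered′ s s∈ with covered s s∈
  ... | inj₁ s≡p               = inj₁ s≡p
  ... | inj₂ (inj₁ s≡q)        = inj₂ (inj₁ s≡q)
  ... | inj₂ (inj₂ (inj₁ s≡p)) = inj₁ s≡p
  ... | inj₂ (inj₂ (inj₂ s≡t)) = inj₂ (inj₂ s≡t)
... | inj₂ refl =
  repeated-value-IsAP₃ a≢b b≢c a≢c q∈ p∈ r∈ (≢-sym p≢q) q≢r covered′ (≡.sym e)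
  where
  covered′ : ∀ s → s ∈₃ (a , b , c) → s ≡ q ⊎ s ≡ p ⊎ s ≡ r
  covered′ s s∈ with covered s s∈
  ... | inj₁ s≡p               = inj₂ (inj₁ s≡p)
  ... | inj₂ (inj₁ s≡q)        = inj₁ s≡q
  ... | inj₂ (inj₂ (inj₁ s≡r)) = inj₂ (inj₂ s≡r)
  ... | inj₂ (inj₂ (inj₂ s≡q)) = inj₁ s≡q

adjacent-sums-distinct : ∀ {V : Set} {l : V → ℕ} → Injective _≡_ _≡_ l →
                         ∀ {u w} v → u ≢ w → l u + l v ≢ l v + l w
adjacent-sums-distinct {l = l} l-injective {u} {w} v u≢w e =
  u≢w (l-injective (+-cancelʳ-≡ (l v) (l u) (l w) (trans e (+-comm (l v) (l w)))))

cycle-sums-balanced : ∀ w x y z → (w + x) + (y + z) ≡ (x + y) + (z + w)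
cycle-sums-balanced = solve-∀

lemma18 : ∀ {m : ℕ} (G : Graph (Fin m)) (k : ℕ)
    → NoIsolatedVertices (C4 ⊕ G)
    → (l : Fin 4 ⊎ (Fin m ⊎ Fin k) → ℕ)
    → IsSumLabelling (C4 ⊕ (G ⊕ N k)) l
    → (a b c : ℕ)
    → a ≢ b → b ≢ c → a ≢ c
    → (l (inj₁ zero) + l (inj₁ (suc zero))) ∈₃ (a , b , c)
    → (l (inj₁ (suc zero)) + l (inj₁ (suc (suc zero)))) ∈₃ (a , b , c)
    → (l (inj₁ (suc (suc zero))) + l (inj₁ (suc (suc (suc zero))))) ∈₃ (a , b , c)
    → (l (inj₁ (suc (suc (suc zero)))) + l (inj₁ zero)) ∈₃ (a , b , c)
    → (∀ s → s ∈₃ (a , b , c) →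
         (s ≡ l (inj₁ zero) + l (inj₁ (suc zero)))
         ⊎ (s ≡ l (inj₁ (suc zero)) + l (inj₁ (suc (suc zero))))
         ⊎ (s ≡ l (inj₁ (suc (suc zero))) + l (inj₁ (suc (suc (suc zero)))))
         ⊎ (s ≡ l (inj₁ (suc (suc (suc zero)))) + l (inj₁ zero)))
    → IsAP₃ a b c
lemma18 {m} G k _ l (l-injective , _) a b c a≢b b≢c a≢c p∈ q∈ r∈ t∈ covered =
  cycle-sums-IsAP₃ a≢b b≢c a≢c p∈ q∈ r∈ t∈
    (distinct v₁ λ ()) (distinct v₂ λ ()) (distinct v₃ λ ()) (distinct v₀ λ ())
    (cycle-sums-balanced (l v₀) (l v₁) (l v₂) (l v₃)) covered
  where
  V : Set
  V = Fin 4 ⊎ (Fin m ⊎ Fin k)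

  distinct : ∀ {u w} v → u ≢ w → l u + l v ≢ l v + l w
  distinct = adjacent-sums-distinct l-injective

  v₀ v₁ v₂ v₃ : V
  v₀ = inj₁ zero
  v₁ = inj₁ (suc zero)
  v₂ = inj₁ (suc (suc zero))
  v₃ = inj₁ (suc (suc (suc zero)))
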